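{- Let $\Theta_1$ and $\Theta_2$ be two distinct commuting involutive antimorphisms on $\mathcal{A}^*$. If $\mathbf{u}$ is an infinite word with language closed under $\Theta_1$ and $\Theta_2$, then for all $n\ge 1$, $$\Delta\mathcal{C}(n)+4 \ge \mathcal{P}_{\Theta_1}(n)+\mathcal{P}_{\Theta_2}(n)-\mathcal{P}_{\Theta_1,\Theta_2}(n)+\mathcal{P}_{\Theta_1}(n+1)+\mathcal{P}_{\Theta_2}(n+1)-\mathcal{P}_{\Theta_1,\Theta_2}(n+1),$$ where $\mathcal{P}_{\Theta_1,\Theta_2}(k)=\#\{w\in\mathcal{L}_k(\mathbf{u}) \mid w=\Theta_1(w)=\Theta_2(w)\}$.
   Context: An antimorphism on $\mathcal{A}^*$ is a map $\Theta$ with $\Theta(vw)=\Theta(w)\Theta(v)$; involutive means $\Theta^2=\mathrm{Id}$. $\mathcal{L}_n(\mathbf{u})$ is the set of factors of $\mathbf{u}$ of length $n$ and $\mathcal{L}(\mathbf{u})$ the set of all factors; the language is closed under $\Theta$ if $\Theta(\mathcal{L}(\mathbf{u}))\subseteq\mathcal{L}(\mathbf{u})$. $\mathcal{C}(n)=\#\mathcal{L}_n(\mathbf{u})$ is the factor complexity and $\Delta\mathcal{C}(n)=\mathcal{C}(n+1)-\mathcal{C}(n)$. For an antimorphism $\Theta$, $\mathcal{P}_\Theta(n)=\#\{w\in\mathcal{L}_n(\mathbf{u}) \mid \Theta(w)=w\}$. The alphabet $\mathcal{A}$ is assumed to consist exactly of the letters occurring in $\mathbf{u}$. -}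

module Defs where

open import Data.Nat using (ℕ; zero; suc; _+_)
open import Data.Fin using (Fin)
open import Data.List using (List; []; _∷_; _++_; length)
open import Data.List.Membership.Propositional using (_∈_)
open import Data.List.Relation.Unary.Unique.Propositional using (Unique)
open import Data.Product using (Σ; ∃; ∃-syntax; _×_; _,_)
open import Relation.Binary.PropositionalEquality using (_≡_)
open import Relation.Nullary using (¬_)

slice : {A : Set} → (ℕ → A) → ℕ → ℕ → List A
slice u i zero    = []
slice u i (suc n) = u i ∷ slice u (suc i) n

IsFactor : {A : Set} → (ℕ → A) → List A → Set
IsFactor u w = ∃[ i ] slice u i (length w) ≡ w

InLn : {A : Set} → (ℕ → A) → ℕ → List A → Set
InLn u n w = IsFactor u w × length w ≡ n

IsAntimorphism : {A : Set} → (List A → List A) → Set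
IsAntimorphism Θ = ∀ v w → Θ (v ++ w) ≡ Θ w ++ Θ v

IsInvolutive : {A : Set} → (List A → List A) → Set
IsInvolutive Θ = ∀ w → Θ (Θ w) ≡ w

LangClosedUnder : {A : Set} → (ℕ → A) → (List A → List A) → Set
LangClosedUnder u Θ = ∀ w → IsFactor u w → IsFactor u (Θ w)

HasCard : {A : Set} → (List A → Set) → ℕ → Set
HasCard {A} P c = Σ (List (List A)) λ L →
  Unique L × length L ≡ c × (∀ w → (w ∈ L → P w) × (P w → w ∈ L))

ComplexityIs : {A : Set} → (ℕ → A) → ℕ → ℕ → Set
ComplexityIs u n c = HasCard (InLn u n) c

PalComplexityIs : {A : Set} → (ℕ → A) → (List A → List A) → ℕ → ℕ → Set
PalComplexityIs u Θ n c = HasCard (λ w → InLn u n w × Θ w ≡ w) c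

PalComplexity2Is : {A : Set} → (ℕ → A) → (List A → List A) → (List A → List A) → ℕ → ℕ → Set
PalComplexity2Is u Θ₁ Θ₂ n c = HasCard (λ w → InLn u n w × Θ₁ w ≡ w × Θ₂ w ≡ w) c

-- As Θ₁ and Θ₂ commute, G = {id, Θ₁, Θ₂, Θ₁Θ₂} is a Klein four-group acting on the factors of each
-- length; call a word a palindrome if Θ₁ or Θ₂ fixes it. By inclusion–exclusion the left-hand side
-- counts the palindromes of lengths n and n + 1, so the claim reads
--   C(n) + #(palindromes in L_n) ≤ #(non-palindromes in L_{n+1}) + 4.
-- Weigh each factor of length n by 1, or by 2 if it is a palindrome: a G-orbit weighs at most 4, and
-- at most 2 if Θ₁Θ₂ fixes its elements. Read u from the left. Whenever the length-n factor v at
-- position k + 1 lies in an orbit not met at positions 0, …, k, the length-(n+1) factor e at position k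
-- is no palindrome (its suffix v would be a Θ-image of its prefix), its orbit avoids the earlier such
-- factors (were e an image of e′, then v would lie in the orbit of the prefix or of the suffix of e′),
-- and it has at least as many elements as the orbit of v weighs: two as e ≠ Θ₁ e, and four unless
-- Θ₁Θ₂ fixes e, in which case it fixes v. The first orbit accounts for the 4.

module Submission where

open import Defs
open import Data.Nat using (ℕ; zero; suc; _≥_)
open import Data.Fin using (Fin)
open import Data.List using (List; []; _∷_; [_]; _++_; length; take; drop; filter; map)
open import Data.Product using (∃-syntax; _×_; _,_; proj₁; proj₂)
open import Relation.Binary.PropositionalEquality
  using (_≡_; _≢_; ≢-sym; refl; sym; trans; cong; cong₂; subst; subst₂; module ≡-Reasoning)
open import Relation.Nullary using (¬_; Dec; yes; no; ¬?; _×-dec_; contradiction)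

import Data.Fin as Fin
open import Data.Bool using (Bool; true; false; _xor_; if_then_else_)
open import Data.Bool.Properties using (xor-same; xor-comm)
open import Data.Empty using (⊥)
open import Data.List.Properties using (filter-all; filter-none; filter-notAll; ++-identityʳ-unique; length-++; ≡-dec)
open import Data.List.Membership.Propositional using (_∈_)
open import Data.List.Membership.Propositional.Properties using (∈-filter⁺; ∈-filter⁻; ∈-map⁻)
open import Data.List.Relation.Unary.All as All using ([]; _∷_)
open import Data.List.Relation.Unary.AllPairs using ([]; _∷_)
open import Data.List.Relation.Unary.Any as Any using (here; there)
open import Data.List.Relation.Unary.Unique.Propositional using (Unique)
open import Data.List.Relation.Unary.Unique.Propositional.Properties using (filter⁺)
open import Data.Sum as Sum using (_⊎_; inj₁; inj₂; [_,_]′)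
open import Function using (_∘_; id)
open import Relation.Binary.Definitions using (DecidableEquality)
open import Relation.Nullary.Decidable using (map′)
open import Relation.Unary using (Decidable; ∁; _∪_; _∩_)
open import Relation.Unary.Properties using (_∪?_; _∩?_; ∁?)

module Counting {A : Set} where

  open import Data.Nat using (_+_; _≤_; z≤n; s≤s)
  open import Data.Nat.Properties using (+-suc; +-identityʳ; m≤n⇒m≤1+n; m≤m+n; ≤-reflexive; ≤-trans)

  count : {P : A → Set} → Decidable P → List A → ℕ
  count P? xs = length (filter P? xs)

  module _ {P : A → Set} (P? : Decidable P) where

    count-all : ∀ xs → (∀ {x} → x ∈ xs → P x) → count P? xs ≡ length xs
    count-all _ all = cong length (filter-all P? (All.tabulate all))

    count-none : ∀ xs → (∀ {x} → x ∈ xs → ¬ P x) → count P? xs ≡ 0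
    count-none _ none = cong length (filter-none P? (All.tabulate none))

    count-∁ : ∀ xs → count P? xs + count (∁? P?) xs ≡ length xs
    count-∁ [] = refl
    count-∁ (y ∷ ys) with P? y
    ... | yes _ = cong suc (count-∁ ys)
    ... | no _  = trans (+-suc _ _) (cong suc (count-∁ ys))

  module _ {P Q : A → Set} (P? : Decidable P) (Q? : Decidable Q) where

    count-mono : ∀ xs → (∀ {x} → x ∈ xs → P x → Q x) → count P? xs ≤ count Q? xs
    count-mono [] _ = z≤n
    count-mono (y ∷ ys) P⇒Q with P? y | Q? y
    ... | yes _ | yes _ = s≤s (count-mono ys (P⇒Q ∘ there))
    ... | yes p | no ¬q = contradiction (P⇒Q (here refl) p) ¬q
    ... | no _  | yes _ = m≤n⇒m≤1+n (count-mono ys (P⇒Q ∘ there))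
    ... | no _  | no _  = count-mono ys (P⇒Q ∘ there)

    count-∪-∩ : ∀ xs → count P? xs + count Q? xs ≡ count (P? ∪? Q?) xs + count (P? ∩? Q?) xs
    count-∪-∩ [] = refl
    count-∪-∩ (y ∷ ys) with P? y | Q? y
    ... | yes _ | yes _ = cong suc (trans (+-suc _ _) (trans (cong suc (count-∪-∩ ys)) (sym (+-suc _ _))))
    ... | yes _ | no _  = cong suc (count-∪-∩ ys)
    ... | no _  | yes _ = trans (+-suc _ _) (cong suc (count-∪-∩ ys))
    ... | no _  | no _  = count-∪-∩ ys

    count-∪-≤ : ∀ xs → count (P? ∪? Q?) xs ≤ count P? xs + count Q? xs
    count-∪-≤ xs = ≤-trans (m≤m+n _ _) (≤-reflexive (sym (count-∪-∩ xs)))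

    count-∪-disjoint : ∀ xs → (∀ {x} → P x → ¬ Q x) → count (P? ∪? Q?) xs ≡ count P? xs + count Q? xs
    count-∪-disjoint xs disjoint = begin
      count (P? ∪? Q?) xs                        ≡⟨ +-identityʳ _ ⟨
      count (P? ∪? Q?) xs + 0                    ≡⟨ cong (count (P? ∪? Q?) xs +_) none ⟨
      count (P? ∪? Q?) xs + count (P? ∩? Q?) xs  ≡⟨ count-∪-∩ xs ⟨
      count P? xs + count Q? xs                  ∎
      where
      open ≡-Reasoning
      none : count (P? ∩? Q?) xs ≡ 0
      none = count-none (P? ∩? Q?) xs λ _ (p , q) → disjoint p q

module Cardinality {A : Set} (_≟_ : DecidableEquality A) where

  open import Data.Nat using (_≤_; z≤n; s≤s)
  open import Data.Nat.Properties using (≤-trans; ≤-antisym)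

  unique-⊆⇒length-≤ : ∀ {xs ys : List A} → Unique xs → (∀ {z} → z ∈ xs → z ∈ ys)
                    → length xs ≤ length ys
  unique-⊆⇒length-≤ {[]} _ _ = z≤n
  unique-⊆⇒length-≤ {x ∷ xs} {ys} (x∉xs ∷ unique) xs⊆ys =
    ≤-trans (s≤s (unique-⊆⇒length-≤ unique xs⊆ys-x)) (filter-notAll ≢x? ys x∈ys)
    where
    ≢x? : Decidable (_≢ x)
    ≢x? y = ¬? (y ≟ x)
    xs⊆ys-x : ∀ {z} → z ∈ xs → z ∈ filter ≢x? ys
    xs⊆ys-x z∈xs = ∈-filter⁺ ≢x? (xs⊆ys (there z∈xs)) (≢-sym (All.lookup x∉xs z∈xs))
    x∈ys : Any.Any (∁ (_≢ x)) ys
    x∈ys = Any.map (λ x≡y y≢x → y≢x (sym x≡y)) (xs⊆ys (here refl))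

  unique-⊆⊇⇒length-≡ : ∀ {xs ys : List A} → Unique xs → Unique ys
                     → (∀ {z} → z ∈ xs → z ∈ ys) → (∀ {z} → z ∈ ys → z ∈ xs) → length xs ≡ length ys
  unique-⊆⊇⇒length-≡ uxs uys ⊆ ⊇ = ≤-antisym (unique-⊆⇒length-≤ uxs ⊆) (unique-⊆⇒length-≤ uys ⊇)

module Enumeration {B : Set} (_≟_ : DecidableEquality B) where

  open Counting
  open Cardinality (≡-dec _≟_)

  hasCard⇒count : {Q R : List B → Set} (R? : Decidable R) {L : List (List B)} {k : ℕ}
                → Unique L → (∀ w → (w ∈ L → Q w) × (Q w → w ∈ L))
                → HasCard (Q ∩ R) k → k ≡ count R? L
  hasCard⇒count R? {L} uniqueL memL (K , uniqueK , refl , memK) =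
    unique-⊆⊇⇒length-≡ uniqueK (filter⁺ R? uniqueL) K⊆ ⊇K
    where
    K⊆ : ∀ {w} → w ∈ K → w ∈ filter R? L
    K⊆ {w} w∈K = let (q , r) = proj₁ (memK w) w∈K in ∈-filter⁺ R? (proj₂ (memL w) q) r
    ⊇K : ∀ {w} → w ∈ filter R? L → w ∈ K
    ⊇K {w} w∈L′ = let (w∈L , r) = ∈-filter⁻ R? w∈L′ in proj₂ (memK w) (proj₁ (memL w) w∈L , r)

module Antimorphism {A : Set} (Θ : List A → List A) (anti : IsAntimorphism Θ) (invol : IsInvolutive Θ) where

  open import Data.Nat using (_+_; _≤_; z≤n; s≤s)
  open import Data.Nat.Properties using (+-comm; +-mono-≤; ≤-antisym; suc-injective; module ≤-Reasoning)

  Θ-[] : Θ [] ≡ []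
  Θ-[] = ++-identityʳ-unique (Θ []) (anti [] [])

  1≤length-Θ-letter : ∀ x → 1 ≤ length (Θ [ x ])
  1≤length-Θ-letter x with Θ [ x ] in eq
  ... | _ ∷ _ = s≤s z≤n
  ... | []    = contradiction (trans (sym (invol [ x ])) (trans (cong Θ eq) Θ-[])) λ ()

  length-≤-Θ : ∀ w → length w ≤ length (Θ w)
  length-≤-Θ [] = z≤n
  length-≤-Θ (x ∷ w) = begin
    1 + length w                     ≤⟨ +-mono-≤ (1≤length-Θ-letter x) (length-≤-Θ w) ⟩
    length (Θ [ x ]) + length (Θ w)  ≡⟨ +-comm (length (Θ [ x ])) (length (Θ w)) ⟩
    length (Θ w) + length (Θ [ x ])  ≡⟨ length-++ (Θ w) ⟨
    length (Θ w ++ Θ [ x ])          ≡⟨ cong length (anti [ x ] w) ⟨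
    length (Θ (x ∷ w))               ∎
    where open ≤-Reasoning

  length-Θ : ∀ w → length (Θ w) ≡ length w
  length-Θ w = ≤-antisym (subst (λ v → length (Θ w) ≤ length v) (invol w) (length-≤-Θ (Θ w))) (length-≤-Θ w)

  take-Θ : ∀ {n} w → length w ≡ suc n → take n (Θ w) ≡ Θ (drop 1 w)
  take-Θ {n} (x ∷ w) len = trans (cong (take n) (anti [ x ] w)) (take-++ (Θ w) (trans (length-Θ w) (suc-injective len)))
    where
    take-++ : ∀ {m} (xs : List A) {ys} → length xs ≡ m → take m (xs ++ ys) ≡ xs
    take-++ [] refl = refl
    take-++ (x ∷ xs) refl = cong (x ∷_) (take-++ xs refl)

  drop-Θ : ∀ {n} w → length w ≡ suc n → drop 1 (Θ w) ≡ Θ (take n w)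
  drop-Θ {n} w len = begin
    drop 1 (Θ w)              ≡⟨ invol _ ⟨
    Θ (Θ (drop 1 (Θ w)))      ≡⟨ cong Θ (take-Θ (Θ w) (trans (length-Θ w) len)) ⟨
    Θ (take n (Θ (Θ w)))      ≡⟨ cong (Θ ∘ take n) (invol w) ⟩
    Θ (take n w)              ∎
    where open ≡-Reasoning

applyIf : {B : Set} → Bool → (B → B) → B → B
applyIf b f = if b then f else id

applyIf-xor : {B : Set} {f : B → B} → (∀ x → f (f x) ≡ x)
            → ∀ a b x → applyIf a f (applyIf b f x) ≡ applyIf (a xor b) f x
applyIf-xor invol true  true  x = invol x
applyIf-xor invol true  false x = refl
applyIf-xor invol false b     x = refl

applyIf-comm : {B : Set} {f g : B → B} → (∀ x → f (g x) ≡ g (f x))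
             → ∀ a b x → applyIf a f (applyIf b g x) ≡ applyIf b g (applyIf a f x)
applyIf-comm comm true  true  x = comm x
applyIf-comm comm true  false x = refl
applyIf-comm comm false true  x = refl
applyIf-comm comm false false x = refl

module Palindromes {A : Set} (_≟_ : DecidableEquality A) (Θ₁ Θ₂ : List A → List A) where

  open import Data.Nat using (_+_)
  open Counting
  open Enumeration _≟_

  Fixed : (List A → List A) → List A → Set
  Fixed Θ w = Θ w ≡ w

  fixed? : ∀ Θ → Decidable (Fixed Θ)
  fixed? Θ w = ≡-dec _≟_ (Θ w) w

  Pal : List A → Set
  Pal = Fixed Θ₁ ∪ Fixed Θ₂

  Pal? : Decidable Pal
  Pal? = fixed? Θ₁ ∪? fixed? Θ₂

  count-Pal : {Q : List A → Set} {L : List (List A)} {a b c : ℕ}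
            → Unique L → (∀ w → (w ∈ L → Q w) × (Q w → w ∈ L))
            → HasCard (Q ∩ Fixed Θ₁) a → HasCard (Q ∩ Fixed Θ₂) b
            → HasCard (Q ∩ (Fixed Θ₁ ∩ Fixed Θ₂)) c
            → a + b ≡ count Pal? L + c
  count-Pal {Q} {L} {a} {b} {c} uniqueL memL card₁ card₂ card₁₂ = begin
    a + b                                            ≡⟨ cong₂ _+_ (count₁ card₁) (count₁ card₂) ⟩
    count (fixed? Θ₁) L + count (fixed? Θ₂) L        ≡⟨ count-∪-∩ (fixed? Θ₁) (fixed? Θ₂) L ⟩
    count Pal? L + count (fixed? Θ₁ ∩? fixed? Θ₂) L  ≡⟨ cong (count Pal? L +_) (count₁ card₁₂) ⟨
    count Pal? L + c                                 ∎
    where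
    open ≡-Reasoning
    count₁ : ∀ {R : List A → Set} {R? : Decidable R} {k} → HasCard (Q ∩ R) k → k ≡ count R? L
    count₁ {R? = R?} = hasCard⇒count R? uniqueL memL

module KleinOrbits {A : Set} (_≟_ : DecidableEquality A) (Θ₁ Θ₂ : List A → List A)
  (anti₁ : IsAntimorphism Θ₁) (invol₁ : IsInvolutive Θ₁)
  (anti₂ : IsAntimorphism Θ₂) (invol₂ : IsInvolutive Θ₂)
  (comm : ∀ w → Θ₁ (Θ₂ w) ≡ Θ₂ (Θ₁ w)) where

  open import Data.Nat using (_+_; _≤_)
  open import Data.Nat.Properties using (+-mono-≤; ≤-trans; +-identityʳ; +-commutativeSemigroup; module ≤-Reasoning)
  open import Algebra.Properties.CommutativeSemigroup +-commutativeSemigroup using (interchange)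
  open import Data.List.Membership.DecPropositional (≡-dec _≟_) using (_∈?_)
  open Counting
  open Cardinality (≡-dec _≟_)
  open Palindromes _≟_ Θ₁ Θ₂
  open Antimorphism Θ₁ anti₁ invol₁ renaming (take-Θ to take-Θ₁; drop-Θ to drop-Θ₁; length-Θ to length-Θ₁)
  open Antimorphism Θ₂ anti₂ invol₂ renaming (take-Θ to take-Θ₂; drop-Θ to drop-Θ₂; length-Θ to length-Θ₂)

  Word : Set
  Word = List A

  Klein : Set
  Klein = Bool × Bool

  act : Klein → Word → Word
  act (a , b) w = applyIf a Θ₁ (applyIf b Θ₂ w)

  _∙_ : Klein → Klein → Klein
  (a , b) ∙ (c , d) = (a xor c , b xor d)

  act-∙ : ∀ g h w → act g (act h w) ≡ act (g ∙ h) w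
  act-∙ (a , b) (c , d) w = begin
    applyIf a Θ₁ (applyIf b Θ₂ (applyIf c Θ₁ (applyIf d Θ₂ w)))
      ≡⟨ cong (applyIf a Θ₁) (applyIf-comm comm c b _) ⟨
    applyIf a Θ₁ (applyIf c Θ₁ (applyIf b Θ₂ (applyIf d Θ₂ w)))
      ≡⟨ applyIf-xor invol₁ a c _ ⟩
    applyIf (a xor c) Θ₁ (applyIf b Θ₂ (applyIf d Θ₂ w))
      ≡⟨ cong (applyIf (a xor c) Θ₁) (applyIf-xor invol₂ b d w) ⟩
    applyIf (a xor c) Θ₁ (applyIf (b xor d) Θ₂ w)
      ∎
    where open ≡-Reasoning

  act-self-inverse : ∀ g w → act g (act g w) ≡ w
  act-self-inverse g@(a , b) w = trans (act-∙ g g w) (cong₂ (λ a b → act (a , b) w) (xor-same a) (xor-same b))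

  act-comm : ∀ g h w → act g (act h w) ≡ act h (act g w)
  act-comm g@(a , b) h@(c , d) w =
    trans (act-∙ g h w) (trans (cong₂ (λ a b → act (a , b) w) (xor-comm a c) (xor-comm b d)) (sym (act-∙ h g w)))

  act-injective : ∀ g {x y} → act g x ≡ act g y → x ≡ y
  act-injective g {x} {y} eq = trans (sym (act-self-inverse g x)) (trans (cong (act g) eq) (act-self-inverse g y))

  length-act : ∀ g w → length (act g w) ≡ length w
  length-act (false , false) w = refl
  length-act (true  , false) w = length-Θ₁ w
  length-act (false , true)  w = length-Θ₂ w
  length-act (true  , true)  w = trans (length-Θ₁ (Θ₂ w)) (length-Θ₂ w)

  _∼_ : Word → Word → Set
  x ∼ y = ∃[ g ] x ≡ act g y

  ≡⇒∼ : ∀ {x y} → x ≡ y → x ∼ y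
  ≡⇒∼ x≡y = (false , false) , x≡y

  ∼-sym : ∀ {x y} → x ∼ y → y ∼ x
  ∼-sym {y = y} (g , refl) = g , sym (act-self-inverse g y)

  ∼-trans : ∀ {x y z} → x ∼ y → y ∼ z → x ∼ z
  ∼-trans {z = z} (g , refl) (h , refl) = g ∙ h , act-∙ g h z

  elements : List Klein
  elements = (false , false) ∷ (true , false) ∷ (false , true) ∷ (true , true) ∷ []

  orbit : Word → List Word
  orbit y = map (λ g → act g y) elements

  ∼⇒∈orbit : ∀ {x y} → x ∼ y → x ∈ orbit y
  ∼⇒∈orbit ((false , false) , refl) = here refl
  ∼⇒∈orbit ((true  , false) , refl) = there (here refl)
  ∼⇒∈orbit ((false , true)  , refl) = there (there (here refl))
  ∼⇒∈orbit ((true  , true)  , refl) = there (there (there (here refl)))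

  ∈orbit⇒∼ : ∀ {x y} → x ∈ orbit y → x ∼ y
  ∈orbit⇒∼ {y = y} x∈orbit = let g , _ , x≡gy = ∈-map⁻ (λ g → act g y) {xs = elements} x∈orbit in g , x≡gy

  _∼?_ : ∀ x y → Dec (x ∼ y)
  x ∼? y = map′ ∈orbit⇒∼ ∼⇒∈orbit (x ∈? orbit y)

  Pal-resp-∼ : ∀ {x y} → x ∼ y → Pal y → Pal x
  Pal-resp-∼ (g , refl) (inj₁ fix) = inj₁ (trans (act-comm (true , false) g _) (cong (act g) fix))
  Pal-resp-∼ (g , refl) (inj₂ fix) = inj₂ (trans (act-comm (false , true) g _) (cong (act g) fix))

  orbit-fixed₁ : ∀ {x s} → Θ₁ s ≡ s → x ∼ s → x ∈ s ∷ Θ₂ s ∷ []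
  orbit-fixed₁ fix ((false , false) , refl) = here refl
  orbit-fixed₁ fix ((true  , false) , refl) = here fix
  orbit-fixed₁ fix ((false , true)  , refl) = there (here refl)
  orbit-fixed₁ fix ((true  , true)  , refl) = there (here (trans (comm _) (cong Θ₂ fix)))

  orbit-fixed₂ : ∀ {x s} → Θ₂ s ≡ s → x ∼ s → x ∈ s ∷ Θ₁ s ∷ []
  orbit-fixed₂ fix ((false , false) , refl) = here refl
  orbit-fixed₂ fix ((true  , false) , refl) = there (here refl)
  orbit-fixed₂ fix ((false , true)  , refl) = here fix
  orbit-fixed₂ fix ((true  , true)  , refl) = there (here (cong Θ₁ fix))

  orbit-fixed₁₂ : ∀ {x s} → Θ₁ (Θ₂ s) ≡ s → x ∼ s → x ∈ s ∷ Θ₁ s ∷ []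
  orbit-fixed₁₂ fix ((false , false) , refl) = here refl
  orbit-fixed₁₂ fix ((true  , false) , refl) = there (here refl)
  orbit-fixed₁₂ fix ((false , true)  , refl) = there (here (trans (sym (invol₁ _)) (cong Θ₁ fix)))
  orbit-fixed₁₂ fix ((true  , true)  , refl) = here fix

  fixed₁₂-Pal⇒fixed₁ : ∀ {s} → Θ₁ (Θ₂ s) ≡ s → Pal s → Θ₁ s ≡ s
  fixed₁₂-Pal⇒fixed₁ fix (inj₁ fix₁) = fix₁
  fixed₁₂-Pal⇒fixed₁ fix (inj₂ fix₂) = trans (cong Θ₁ (sym fix₂)) fix

  orbit-fixed₁₂-Pal : ∀ {x s} → Θ₁ (Θ₂ s) ≡ s → Pal s → x ∼ s → x ∈ [ s ]
  orbit-fixed₁₂-Pal fix pal x∼s with orbit-fixed₁₂ fix x∼s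
  ... | here x≡s           = here x≡s
  ... | there (here x≡Θ₁s) = here (trans x≡Θ₁s (fixed₁₂-Pal⇒fixed₁ fix pal))

  weight : {P : Word → Set} → Decidable P → List Word → ℕ
  weight P? L = count P? L + count (P? ∩? Pal?) L

  weight-mono : ∀ {P Q : Word → Set} (P? : Decidable P) (Q? : Decidable Q) L
              → (∀ {x} → x ∈ L → P x → Q x) → weight P? L ≤ weight Q? L
  weight-mono P? Q? L P⇒Q =
    +-mono-≤ (count-mono P? Q? L P⇒Q)
             (count-mono (P? ∩? Pal?) (Q? ∩? Pal?) L λ x∈L (p , pal) → P⇒Q x∈L p , pal)

  weight-∪ : ∀ {P Q : Word → Set} (P? : Decidable P) (Q? : Decidable Q) L
           → weight (P? ∪? Q?) L ≤ weight P? L + weight Q? L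
  weight-∪ {P} {Q} P? Q? L = begin
    count (P? ∪? Q?) L + count ((P? ∪? Q?) ∩? Pal?) L
      ≤⟨ +-mono-≤ (count-∪-≤ P? Q? L)
                  (≤-trans (count-mono ((P? ∪? Q?) ∩? Pal?) ((P? ∩? Pal?) ∪? (Q? ∩? Pal?)) L distrib)
                           (count-∪-≤ (P? ∩? Pal?) (Q? ∩? Pal?) L)) ⟩
    (count P? L + count Q? L) + (count (P? ∩? Pal?) L + count (Q? ∩? Pal?) L)
      ≡⟨ interchange (count P? L) (count Q? L) (count (P? ∩? Pal?) L) (count (Q? ∩? Pal?) L) ⟩
    weight P? L + weight Q? L  ∎
    where
    open ≤-Reasoning
    distrib : ∀ {x} → x ∈ L → ((P ∪ Q) ∩ Pal) x → ((P ∩ Pal) ∪ (Q ∩ Pal)) x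
    distrib _ (inj₁ p , pal) = inj₁ (p , pal)
    distrib _ (inj₂ q , pal) = inj₂ (q , pal)

  count-orbit-≤ : ∀ {s L xs} → Unique L → (∀ {x} → x ∼ s → x ∈ xs) → count (_∼? s) L ≤ length xs
  count-orbit-≤ {s} {L} uniqueL ⊆xs =
    unique-⊆⇒length-≤ (filter⁺ (_∼? s) uniqueL)
                      (λ x∈L′ → ⊆xs (proj₂ (∈-filter⁻ (_∼? s) {xs = L} x∈L′)))

  orbit-weight-≤-double : ∀ {s L xs} → Unique L → (∀ {x} → x ∼ s → x ∈ xs)
                        → weight (_∼? s) L ≤ length xs + length xs
  orbit-weight-≤-double {s} {L} uniqueL ⊆xs =
    +-mono-≤ (count-orbit-≤ uniqueL ⊆xs)
             (≤-trans (count-mono ((_∼? s) ∩? Pal?) (_∼? s) L (λ _ → proj₁)) (count-orbit-≤ uniqueL ⊆xs))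

  orbit-weight-¬Pal : ∀ {s L xs} → Unique L → ¬ Pal s → (∀ {x} → x ∼ s → x ∈ xs)
                    → weight (_∼? s) L ≤ length xs
  orbit-weight-¬Pal {s} {L} {xs} uniqueL ¬pal ⊆xs = begin
    count (_∼? s) L + count ((_∼? s) ∩? Pal?) L  ≡⟨ cong (count (_∼? s) L +_) none ⟩
    count (_∼? s) L + 0                          ≡⟨ +-identityʳ _ ⟩
    count (_∼? s) L                              ≤⟨ count-orbit-≤ uniqueL ⊆xs ⟩
    length xs                                    ∎
    where
    open ≤-Reasoning
    none : count ((_∼? s) ∩? Pal?) L ≡ 0
    none = count-none ((_∼? s) ∩? Pal?) L λ _ (x∼s , pal) → ¬pal (Pal-resp-∼ (∼-sym x∼s) pal)

  orbit-weight-≤4 : ∀ {L} → Unique L → ∀ s → weight (_∼? s) L ≤ 4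
  orbit-weight-≤4 uniqueL s with Pal? s
  ... | yes (inj₁ fix) = orbit-weight-≤-double uniqueL (orbit-fixed₁ fix)
  ... | yes (inj₂ fix) = orbit-weight-≤-double uniqueL (orbit-fixed₂ fix)
  ... | no ¬pal        = orbit-weight-¬Pal uniqueL ¬pal ∼⇒∈orbit

  orbit-weight-≤2 : ∀ {L} → Unique L → ∀ {s} → Θ₁ (Θ₂ s) ≡ s → weight (_∼? s) L ≤ 2
  orbit-weight-≤2 uniqueL {s} fix with Pal? s
  ... | yes pal = orbit-weight-≤-double uniqueL (orbit-fixed₁₂-Pal fix pal)
  ... | no ¬pal = orbit-weight-¬Pal uniqueL ¬pal (orbit-fixed₁₂ fix)

  length-≤-count-orbit : ∀ {e L xs} → (∀ {x} → x ∼ e → x ∈ L)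
                       → Unique xs → (∀ {x} → x ∈ xs → x ∼ e) → length xs ≤ count (_∼? e) L
  length-≤-count-orbit {e} orbit⊆L uniqueXs xs⊆orbit =
    unique-⊆⇒length-≤ uniqueXs (λ x∈xs → ∈-filter⁺ (_∼? e) (orbit⊆L (xs⊆orbit x∈xs)) (xs⊆orbit x∈xs))

  2≤count-orbit : ∀ {e L} → (∀ {x} → x ∼ e → x ∈ L) → ¬ Pal e → 2 ≤ count (_∼? e) L
  2≤count-orbit orbit⊆L ¬pal = length-≤-count-orbit orbit⊆L
    (((λ e≡Θ₁e → ¬pal (inj₁ (sym e≡Θ₁e))) ∷ []) ∷ [] ∷ [])
    λ { (here refl) → ≡⇒∼ refl ; (there (here refl)) → (true , false) , refl }

  4≤count-orbit : ∀ {e L} → (∀ {x} → x ∼ e → x ∈ L) → ¬ Pal e → Θ₁ (Θ₂ e) ≢ e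
                → 4 ≤ count (_∼? e) L
  4≤count-orbit {e} orbit⊆L ¬pal ¬fix = length-≤-count-orbit orbit⊆L
    (  (e≢Θ₁e ∷ e≢Θ₂e ∷ ≢-sym ¬fix ∷ [])
     ∷ (Θ₁e≢Θ₂e ∷ Θ₁e≢Θ₁Θ₂e ∷ [])
     ∷ (Θ₂e≢Θ₁Θ₂e ∷ [])
     ∷ [] ∷ [])
    ∈orbit⇒∼
    where
    e≢Θ₁e : e ≢ Θ₁ e
    e≢Θ₁e e≡Θ₁e = ¬pal (inj₁ (sym e≡Θ₁e))
    e≢Θ₂e : e ≢ Θ₂ e
    e≢Θ₂e e≡Θ₂e = ¬pal (inj₂ (sym e≡Θ₂e))
    Θ₁e≢Θ₂e : Θ₁ e ≢ Θ₂ e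
    Θ₁e≢Θ₂e eq = ¬fix (trans (cong Θ₁ (sym eq)) (invol₁ e))
    Θ₁e≢Θ₁Θ₂e : Θ₁ e ≢ Θ₁ (Θ₂ e)
    Θ₁e≢Θ₁Θ₂e = e≢Θ₂e ∘ act-injective (true , false)
    Θ₂e≢Θ₁Θ₂e : Θ₂ e ≢ Θ₁ (Θ₂ e)
    Θ₂e≢Θ₁Θ₂e eq = e≢Θ₁e (act-injective (false , true) (trans eq (comm e)))

  drop₁-Θ₁Θ₂ : ∀ {n} e → length e ≡ suc n → drop 1 (Θ₁ (Θ₂ e)) ≡ Θ₁ (Θ₂ (drop 1 e))
  drop₁-Θ₁Θ₂ e len = trans (drop-Θ₁ (Θ₂ e) (trans (length-Θ₂ e) len)) (cong Θ₁ (take-Θ₂ e len))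

  drop₁-act : ∀ {n} e → length e ≡ suc n → ∀ g → drop 1 (act g e) ∼ take n e ⊎ drop 1 (act g e) ∼ drop 1 e
  drop₁-act e len (false , false) = inj₂ (≡⇒∼ refl)
  drop₁-act e len (true  , false) = inj₁ ((true , false) , drop-Θ₁ e len)
  drop₁-act e len (false , true)  = inj₁ ((false , true) , drop-Θ₂ e len)
  drop₁-act e len (true  , true)  = inj₂ ((true , true) , drop₁-Θ₁Θ₂ e len)

  Pal⇒drop₁∼take : ∀ {n} e → length e ≡ suc n → Pal e → drop 1 e ∼ take n e
  Pal⇒drop₁∼take e len (inj₁ fix) = (true , false) , trans (cong (drop 1) (sym fix)) (drop-Θ₁ e len)
  Pal⇒drop₁∼take e len (inj₂ fix) = (false , true) , trans (cong (drop 1) (sym fix)) (drop-Θ₂ e len)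

length-slice : {A : Set} (u : ℕ → A) (i m : ℕ) → length (slice u i m) ≡ m
length-slice u i zero = refl
length-slice u i (suc m) = cong suc (length-slice u (suc i) m)

take-slice : {A : Set} (u : ℕ → A) (i m : ℕ) → take m (slice u i (suc m)) ≡ slice u i m
take-slice u i zero = refl
take-slice u i (suc m) = cong (u i ∷_) (take-slice u (suc i) m)

module Scan {A : Set} (_≟_ : DecidableEquality A) (Θ₁ Θ₂ : List A → List A)
  (anti₁ : IsAntimorphism Θ₁) (invol₁ : IsInvolutive Θ₁)
  (anti₂ : IsAntimorphism Θ₂) (invol₂ : IsInvolutive Θ₂)
  (comm : ∀ w → Θ₁ (Θ₂ w) ≡ Θ₂ (Θ₁ w))
  (u : ℕ → A) (closed₁ : LangClosedUnder u Θ₁) (closed₂ : LangClosedUnder u Θ₂) (n : ℕ) where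

  open import Data.Nat using (_+_; _≤_; _<_; _⊔_; _≤′_; ≤′-refl; ≤′-step)
  open import Data.Nat.Properties
    using (≤-refl; ≤-reflexive; ≤-trans; <⇒≤; m≤n⇒m≤1+n; m≤n+m; m≤m⊔n; m≤n⊔m; ≤⇒≤′;
           +-mono-≤; +-monoˡ-≤; +-commutativeSemigroup; module ≤-Reasoning)
  open import Algebra.Properties.CommutativeSemigroup +-commutativeSemigroup using (xy∙z≈xz∙y)
  open Counting
  open Palindromes _≟_ Θ₁ Θ₂
  open KleinOrbits _≟_ Θ₁ Θ₂ anti₁ invol₁ anti₂ invol₂ comm

  -- drop 1 (edge i) reduces to vertex (suc i).
  vertex edge : ℕ → Word
  vertex i = slice u i n
  edge i = slice u i (suc n)

  length-edge : ∀ i → length (edge i) ≡ suc n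
  length-edge i = length-slice u i (suc n)

  edge-factor : ∀ i → InLn u (suc n) (edge i)
  edge-factor i = (i , cong (slice u i) (length-edge i)) , length-edge i

  factor⇒vertex : ∀ {w} → InLn u n w → ∃[ i ] w ≡ vertex i
  factor⇒vertex ((i , slice≡w) , len) = i , sym (trans (cong (slice u i) (sym len)) slice≡w)

  act-factor : ∀ g {w} → IsFactor u w → IsFactor u (act g w)
  act-factor (false , false) factor = factor
  act-factor (true  , false) factor = closed₁ _ factor
  act-factor (false , true)  factor = closed₂ _ factor
  act-factor (true  , true)  factor = closed₁ _ (closed₂ _ factor)

  orbit-factor : ∀ {m w x} → InLn u m w → x ∼ w → InLn u m x
  orbit-factor (factor , len) (g , refl) = act-factor g factor , trans (length-act g _) len

  -- Seen k is the union of the orbits of vertex 0, …, vertex k; New k says that vertex (suc k) opens a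
  -- new orbit, and Found k is the union of the orbits of the edges j < k through which one was opened.
  Seen : ℕ → Word → Set
  Seen zero    v = v ∼ vertex 0
  Seen (suc k) v = Seen k v ⊎ v ∼ vertex (suc k)

  Seen? : ∀ k → Decidable (Seen k)
  Seen? zero    = _∼? vertex 0
  Seen? (suc k) = Seen? k ∪? (_∼? vertex (suc k))

  New : ℕ → Set
  New k = ¬ Seen k (vertex (suc k))

  Found : ℕ → Word → Set
  Found zero    _ = ⊥
  Found (suc k) e = Found k e ⊎ (New k × e ∼ edge k)

  Found? : ∀ k → Decidable (Found k)
  Found? zero    _ = no λ ()
  Found? (suc k) = Found? k ∪? (λ e → ¬? (Seen? k (vertex (suc k))) ×-dec (e ∼? edge k))

  Seen-mono : ∀ {j k v} → j ≤′ k → Seen j v → Seen k v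
  Seen-mono ≤′-refl        seen = seen
  Seen-mono (≤′-step j≤k) seen = inj₁ (Seen-mono j≤k seen)

  ∼vertex⇒Seen : ∀ {j k v} → j ≤ k → v ∼ vertex j → Seen k v
  ∼vertex⇒Seen {j} j≤k v∼ = Seen-mono (≤⇒≤′ j≤k) (at j v∼)
    where
    at : ∀ {v} j → v ∼ vertex j → Seen j v
    at zero    v∼ = v∼
    at (suc j) v∼ = inj₂ v∼

  Seen-resp-∼ : ∀ {k x v} → Seen k v → x ∼ v → Seen k x
  Seen-resp-∼ {zero}  seen        x∼v = ∼-trans x∼v seen
  Seen-resp-∼ {suc k} (inj₁ seen) x∼v = inj₁ (Seen-resp-∼ seen x∼v)
  Seen-resp-∼ {suc k} (inj₂ v∼)   x∼v = inj₂ (∼-trans x∼v v∼)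

  New⇒edge-¬Pal : ∀ {j} → New j → ¬ Pal (edge j)
  New⇒edge-¬Pal {j} new pal =
    new (∼vertex⇒Seen ≤-refl
          (∼-trans (Pal⇒drop₁∼take (edge j) (length-edge j) pal) (≡⇒∼ (take-slice u j n))))

  Found⇒earlier : ∀ {k e} → Found k e → ∃[ j ] j < k × New j × e ∼ edge j
  Found⇒earlier {suc k} (inj₁ found) = let j , j<k , rest = Found⇒earlier found in j , m≤n⇒m≤1+n j<k , rest
  Found⇒earlier {suc k} (inj₂ (new , e∼)) = k , ≤-refl , new , e∼

  Found⇒¬Pal : ∀ {k e} → Found k e → ¬ Pal e
  Found⇒¬Pal found pal =
    let _ , _ , new , e∼ = Found⇒earlier found in New⇒edge-¬Pal new (Pal-resp-∼ (∼-sym e∼) pal)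

  earlier-edge⇒Seen : ∀ {j k} → j < k → edge k ∼ edge j → Seen k (vertex (suc k))
  earlier-edge⇒Seen {j} {k} j<k (g , edge≡) =
    [ (λ ∼prefix → ∼vertex⇒Seen (<⇒≤ j<k) (∼-trans next∼ (∼-trans ∼prefix (≡⇒∼ (take-slice u j n)))))
    , (λ ∼suffix → ∼vertex⇒Seen j<k (∼-trans next∼ ∼suffix))
    ]′ (drop₁-act (edge j) (length-edge j) g)
    where
    next∼ : vertex (suc k) ∼ drop 1 (act g (edge j))
    next∼ = ≡⇒∼ (cong (drop 1) edge≡)

  New⇒unfound : ∀ {k e} → New k → Found k e → ¬ e ∼ edge k
  New⇒unfound new found e∼edge =
    let _ , j<k , _ , e∼edgeⱼ = Found⇒earlier found
    in  new (earlier-edge⇒Seen j<k (∼-trans (∼-sym e∼edge) e∼edgeⱼ))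

  all-Seen : ∀ {xs} → (∀ {w} → w ∈ xs → InLn u n w) → ∃[ K ] ∀ {w} → w ∈ xs → Seen K w
  all-Seen {[]}     _       = 0 , λ ()
  all-Seen {x ∷ xs} factors
    with K , seen ← all-Seen (factors ∘ there) | i , x≡vertex ← factor⇒vertex (factors (here refl)) =
    i ⊔ K , λ { (here refl)    → ∼vertex⇒Seen (m≤m⊔n i K) (≡⇒∼ x≡vertex)
              ; (there w∈xs) → Seen-mono (≤⇒≤′ (m≤n⊔m i K)) (seen w∈xs) }

  module _ {L₀ L₁ : List Word} (unique₀ : Unique L₀) (⊆L₁ : ∀ {w} → InLn u (suc n) w → w ∈ L₁) where

    orbit-edge⊆L₁ : ∀ j {x} → x ∼ edge j → x ∈ L₁
    orbit-edge⊆L₁ j x∼ = ⊆L₁ (orbit-factor (edge-factor j) x∼)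

    New⇒orbit-weight-≤ : ∀ {k} → New k → weight (_∼? vertex (suc k)) L₀ ≤ count (_∼? edge k) L₁
    New⇒orbit-weight-≤ {k} new with ≡-dec _≟_ (Θ₁ (Θ₂ (edge k))) (edge k)
    ... | yes fix = ≤-trans (orbit-weight-≤2 unique₀ vertex-fixed) (2≤count-orbit (orbit-edge⊆L₁ k) (New⇒edge-¬Pal new))
      where
      vertex-fixed : Θ₁ (Θ₂ (vertex (suc k))) ≡ vertex (suc k)
      vertex-fixed = trans (sym (drop₁-Θ₁Θ₂ (edge k) (length-edge k))) (cong (drop 1) fix)
    ... | no ¬fix = ≤-trans (orbit-weight-≤4 unique₀ (vertex (suc k)))
                            (4≤count-orbit (orbit-edge⊆L₁ k) (New⇒edge-¬Pal new) ¬fix)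

    New⇒count-Found : ∀ {k} → New k → count (Found? k) L₁ + count (_∼? edge k) L₁ ≤ count (Found? (suc k)) L₁
    New⇒count-Found {k} new = begin
      count (Found? k) L₁ + count (_∼? edge k) L₁
        ≡⟨ count-∪-disjoint (Found? k) (_∼? edge k) L₁ (New⇒unfound new) ⟨
      count (Found? k ∪? (_∼? edge k)) L₁
        ≤⟨ count-mono (Found? k ∪? (_∼? edge k)) (Found? (suc k)) L₁ (λ _ → Sum.map₂ (new ,_)) ⟩
      count (Found? (suc k)) L₁
        ∎
      where open ≤-Reasoning

    weight-Seen-≤ : ∀ k → weight (Seen? k) L₀ ≤ count (Found? k) L₁ + 4
    weight-Seen-≤ zero = ≤-trans (orbit-weight-≤4 unique₀ (vertex 0)) (m≤n+m 4 _)
    weight-Seen-≤ (suc k) = step (Seen? k (vertex (suc k)))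
      where
      open ≤-Reasoning
      step : Dec (Seen k (vertex (suc k))) → weight (Seen? (suc k)) L₀ ≤ count (Found? (suc k)) L₁ + 4
      step (yes seen) = begin
        weight (Seen? (suc k)) L₀      ≤⟨ weight-mono (Seen? (suc k)) (Seen? k) L₀ (λ _ → [ id , Seen-resp-∼ seen ]′) ⟩
        weight (Seen? k) L₀            ≤⟨ weight-Seen-≤ k ⟩
        count (Found? k) L₁ + 4        ≤⟨ +-monoˡ-≤ 4 (count-mono (Found? k) (Found? (suc k)) L₁ (λ _ → inj₁)) ⟩
        count (Found? (suc k)) L₁ + 4  ∎
      step (no new) = begin
        weight (Seen? (suc k)) L₀                             ≤⟨ weight-∪ (Seen? k) (_∼? vertex (suc k)) L₀ ⟩
        weight (Seen? k) L₀ + weight (_∼? vertex (suc k)) L₀  ≤⟨ +-mono-≤ (weight-Seen-≤ k) (New⇒orbit-weight-≤ new) ⟩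
        count (Found? k) L₁ + 4 + count (_∼? edge k) L₁       ≡⟨ xy∙z≈xz∙y (count (Found? k) L₁) 4 _ ⟩
        count (Found? k) L₁ + count (_∼? edge k) L₁ + 4       ≤⟨ +-monoˡ-≤ 4 (New⇒count-Found new) ⟩
        count (Found? (suc k)) L₁ + 4                         ∎

    complexity-bound : (∀ {w} → w ∈ L₀ → InLn u n w) → length L₀ + count Pal? L₀ ≤ count (∁? Pal?) L₁ + 4
    complexity-bound L₀⊆ with K , seen ← all-Seen L₀⊆ = begin
      length L₀ + count Pal? L₀  ≤⟨ +-mono-≤ (≤-reflexive (sym (count-all (Seen? K) L₀ seen)))
                                             (count-mono Pal? (Seen? K ∩? Pal?) L₀ (λ w∈L₀ pal → seen w∈L₀ , pal)) ⟩
      weight (Seen? K) L₀        ≤⟨ weight-Seen-≤ K ⟩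
      count (Found? K) L₁ + 4    ≤⟨ +-monoˡ-≤ 4 (count-mono (Found? K) (∁? Pal?) L₁ (λ _ → Found⇒¬Pal)) ⟩
      count (∁? Pal?) L₁ + 4     ∎
      where open ≤-Reasoning

import Data.Nat as ℕ
open import Data.Integer using (ℤ; +_; _-_; _+_; _≤_; +≤+)
open import Data.Integer.Properties using (pos-+; +-monoˡ-≤; module ≤-Reasoning)
open import Data.Integer.Tactic.RingSolver using (solve-∀)

pos-+-cancelʳ : ∀ a b c s → a ℕ.+ b ≡ s ℕ.+ c → + a + + b - + c ≡ + s
pos-+-cancelʳ a b c s eq = begin
  + a + + b - + c       ≡⟨ cong (_- + c) (pos-+ a b) ⟨
  + (a ℕ.+ b) - + c     ≡⟨ cong (λ m → + m - + c) eq ⟩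
  + (s ℕ.+ c) - + c     ≡⟨ cong (_- + c) (pos-+ s c) ⟩
  + s + + c - + c       ≡⟨ x+y-y≡x (+ s) (+ c) ⟩
  + s                   ∎
  where
  open ≡-Reasoning
  x+y-y≡x : ∀ (x y : ℤ) → x + y - y ≡ x
  x+y-y≡x = solve-∀

integer-bound : ∀ p₁ p₂ p₁₂ q₁ q₂ q₁₂ c₀ {c₁ s₀ s₁ m}
              → p₁ ℕ.+ p₂ ≡ s₀ ℕ.+ p₁₂ → q₁ ℕ.+ q₂ ≡ s₁ ℕ.+ q₁₂
              → s₁ ℕ.+ m ≡ c₁ → c₀ ℕ.+ s₀ ℕ.≤ m ℕ.+ 4
              → (+ p₁ + + p₂ - + p₁₂) + (+ q₁ + + q₂ - + q₁₂) ≤ (+ c₁ - + c₀) + + 4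
integer-bound p₁ p₂ p₁₂ q₁ q₂ q₁₂ c₀ {_} {s₀} {s₁} {m} p-eq q-eq refl bound = begin
  (+ p₁ + + p₂ - + p₁₂) + (+ q₁ + + q₂ - + q₁₂)
    ≡⟨ cong₂ _+_ (pos-+-cancelʳ p₁ p₂ p₁₂ s₀ p-eq) (pos-+-cancelʳ q₁ q₂ q₁₂ s₁ q-eq) ⟩
  + s₀ + + s₁                                    ≡⟨ rearrange₁ (+ c₀) (+ s₀) (+ s₁) ⟩
  (+ c₀ + + s₀) + (+ s₁ - + c₀)
    ≤⟨ +-monoˡ-≤ (+ s₁ - + c₀) (subst₂ _≤_ (pos-+ c₀ s₀) (pos-+ m 4) (+≤+ bound)) ⟩
  (+ m + + 4) + (+ s₁ - + c₀)                    ≡⟨ rearrange₂ (+ m) (+ 4) (+ s₁) (+ c₀) ⟩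
  (+ s₁ + + m - + c₀) + + 4                      ≡⟨ cong (λ z → z - + c₀ + + 4) (pos-+ s₁ m) ⟨
  (+ (s₁ ℕ.+ m) - + c₀) + + 4                    ∎
  where
  open ≤-Reasoning
  rearrange₁ : ∀ (c s t : ℤ) → s + t ≡ (c + s) + (t - c)
  rearrange₁ = solve-∀
  rearrange₂ : ∀ (m f t c : ℤ) → (m + f) + (t - c) ≡ (t + m - c) + f
  rearrange₂ = solve-∀

theorem3 : (d : ℕ) (u : ℕ → Fin d)
    → (∀ a → ∃[ i ] u i ≡ a)
    → (Θ₁ Θ₂ : List (Fin d) → List (Fin d))
    → IsAntimorphism Θ₁ → IsInvolutive Θ₁
    → IsAntimorphism Θ₂ → IsInvolutive Θ₂
    → ¬ (∀ w → Θ₁ w ≡ Θ₂ w)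
    → (∀ w → Θ₁ (Θ₂ w) ≡ Θ₂ (Θ₁ w))
    → LangClosedUnder u Θ₁ → LangClosedUnder u Θ₂
    → (n : ℕ) → n ≥ 1
    → (c₀ c₁ p₁ p₂ p₁₂ q₁ q₂ q₁₂ : ℕ)
    → ComplexityIs u n c₀ → ComplexityIs u (suc n) c₁
    → PalComplexityIs u Θ₁ n p₁ → PalComplexityIs u Θ₂ n p₂
    → PalComplexity2Is u Θ₁ Θ₂ n p₁₂
    → PalComplexityIs u Θ₁ (suc n) q₁ → PalComplexityIs u Θ₂ (suc n) q₂
    → PalComplexity2Is u Θ₁ Θ₂ (suc n) q₁₂
    → (+ p₁ + + p₂ - + p₁₂) + (+ q₁ + + q₂ - + q₁₂) ≤ (+ c₁ - + c₀) + + 4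
theorem3 d u _ Θ₁ Θ₂ anti₁ invol₁ anti₂ invol₂ _ comm closed₁ closed₂ n _ c₀ c₁ p₁ p₂ p₁₂ q₁ q₂ q₁₂
  (L₀ , unique₀ , refl , mem₀) (L₁ , unique₁ , refl , mem₁) P₁ P₂ P₁₂ Q₁ Q₂ Q₁₂ =
  integer-bound p₁ p₂ p₁₂ q₁ q₂ q₁₂ c₀
    (count-Pal unique₀ mem₀ P₁ P₂ P₁₂)
    (count-Pal unique₁ mem₁ Q₁ Q₂ Q₁₂)
    (count-∁ Pal? L₁)
    (complexity-bound unique₀ (λ {w} → proj₂ (mem₁ w)) (λ {w} → proj₁ (mem₀ w)))
  where
  open Counting
  open Palindromes Fin._≟_ Θ₁ Θ₂
  open Scan Fin._≟_ Θ₁ Θ₂ anti₁ invol₁ anti₂ invol₂ comm u closed₁ closed₂ n
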